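{- Let $G$ be a star $5$-critical subcubic multigraph and let $H$ be the multigraph obtained from $G$ by deleting all vertices of degree $1$. Then for any vertex $x$ of degree $2$ in $H$, $x$ has exactly two distinct neighbors in $H$, i.e. $|N_H(x)|=2$.
   Context: All multigraphs are finite and loopless; subcubic means every vertex has degree at most $3$. A star $k$-edge-coloring of a multigraph is a proper edge-coloring with colors $\{1,\dots,k\}$ such that no path or cycle of length four (four edges) is bi-colored; $\chi'_s(G)$ is the least such $k$. A multigraph $G$ is star $5$-critical if $\chi'_s(G)>5$ and $\chi'_s(G-v)\leq 5$ for every vertex $v\in V(G)$. $N_H(x)$ denotes the set of neighbors of $x$ in $H$ and degrees count edges with multiplicity. -}

module Defs where

open import Data.Nat using (ℕ; zero; suc; _≤_)
open import Data.Fin using (Fin; zero; suc; _≟_)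
open import Data.Bool using (Bool; true; false; _∧_; _∨_; not; if_then_else_)
open import Data.Product using (_×_; _,_; proj₁; proj₂; ∃; Σ)
open import Data.Sum using (_⊎_)
open import Data.Unit using (⊤)
open import Data.Empty using (⊥)
open import Relation.Nullary using (¬_)
open import Relation.Nullary.Decidable using (⌊_⌋)
open import Relation.Binary.PropositionalEquality using (_≡_; _≢_)

-- A finite loopless multigraph: vertices Fin n, edges Fin m (edge identity =
-- index, so parallel edges are allowed), each edge with two distinct ends.
record Multigraph : Set where
  field
    n        : ℕ
    m        : ℕ
    ends     : Fin m → Fin n × Fin n
    loopless : ∀ e → proj₁ (ends e) ≢ proj₂ (ends e)

open Multigraph public

Vertex : Multigraph → Set
Vertex G = Fin (n G)

Edge : Multigraph → Set
Edge G = Fin (m G)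

count : ∀ {k} → (Fin k → Bool) → ℕ
count {zero}  p = 0
count {suc k} p = (if p zero then 1 else 0) Data.Nat.+ count (λ i → p (suc i))

incident : (G : Multigraph) → Vertex G → Edge G → Bool
incident G v e = ⌊ proj₁ (ends G e) ≟ v ⌋ ∨ ⌊ proj₂ (ends G e) ≟ v ⌋

deg : (G : Multigraph) → Vertex G → ℕ
deg G v = count (incident G v)

Subcubic : Multigraph → Set
Subcubic G = ∀ v → deg G v ≤ 3

Joins : (G : Multigraph) → Edge G → Vertex G → Vertex G → Set
Joins G e a b = ends G e ≡ (a , b) ⊎ ends G e ≡ (b , a)

-- Star k-edge-coloring of the subgraph of G induced by the vertex set S
-- (i.e. of G with the vertices outside S deleted).  Colours on edges not
-- inside S are irrelevant.
record StarColoringOn (G : Multigraph) (S : Vertex G → Set) (k : ℕ) : Set where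
  field
    col : Edge G → Fin k
    proper : ∀ (e f : Edge G) (v w w′ : Vertex G) → e ≢ f →
             S v → S w → S w′ → Joins G e v w → Joins G f v w′ →
             col e ≢ col f
    noBicolored4 : ∀ (v₀ v₁ v₂ v₃ v₄ : Vertex G) (e₁ e₂ e₃ e₄ : Edge G) →
             S v₀ → S v₁ → S v₂ → S v₃ → S v₄ →
             Joins G e₁ v₀ v₁ → Joins G e₂ v₁ v₂ →
             Joins G e₃ v₂ v₃ → Joins G e₄ v₃ v₄ →
             v₀ ≢ v₁ → v₀ ≢ v₂ → v₀ ≢ v₃ → v₁ ≢ v₂ → v₁ ≢ v₃ → v₂ ≢ v₃ →
             -- path (v₄ new) or cycle (v₄ = v₀)
             ((v₄ ≢ v₀ × v₄ ≢ v₁ × v₄ ≢ v₂ × v₄ ≢ v₃) ⊎ v₄ ≡ v₀) →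
             -- bi-coloured (proper, so colours alternate)
             col e₁ ≡ col e₃ → col e₂ ≡ col e₄ → ⊥

StarColorable : Multigraph → ℕ → Set
StarColorable G k = StarColoringOn G (λ _ → ⊤) k

StarColorableMinus : (G : Multigraph) → Vertex G → ℕ → Set
StarColorableMinus G v k = StarColoringOn G (λ u → u ≢ v) k

Star5Critical : Multigraph → Set
Star5Critical G = ¬ StarColorable G 5 × (∀ v → StarColorableMinus G v 5)

-- H = G minus all degree-1 vertices: vertex v is kept iff deg_G v ≠ 1
keptH : (G : Multigraph) → Vertex G → Bool
keptH G v = not ⌊ deg G v Data.Nat.≟ 1 ⌋

degH : (G : Multigraph) → Vertex G → ℕ
degH G x = count (λ e →
  (⌊ proj₁ (ends G e) ≟ x ⌋ ∧ keptH G (proj₂ (ends G e))) ∨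
  (⌊ proj₂ (ends G e) ≟ x ⌋ ∧ keptH G (proj₁ (ends G e))))

NeighborH : (G : Multigraph) → Vertex G → Vertex G → Set
NeighborH G x y = keptH G y ≡ true × ∃ λ e → Joins G e x y

-- Let e₁, e₂ be the two edges of H at x.  If their far ends differ we are done; otherwise
-- they form a digon x–y.  Then either x has a third edge of G, whose far end u is deleted
-- in H and hence a leaf, or x carries only the digon.  Accordingly delete u (resp. x):
-- all removed edges go to a single vertex t (x, resp. y), and a star 5-edge-colouring of
-- the remainder extends to G as soon as the removed edges get pairwise distinct colours
-- missing on every edge within distance one beyond t.  Those edges all meet one vertex
-- (y, resp. the neighbour of y off the digon), so subcubicity leaves two such colours,
-- contradicting criticality.
module Submission where

open import Defs
open import Data.Nat using (ℕ; zero; suc; _≤_; _<_; _+_; z≤n; s≤s)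
import Data.Nat as ℕ
open import Data.Nat.Properties using (+-suc; <⇒≱)
open import Data.Fin using (Fin; zero; suc; _≟_)
open import Data.Fin.Properties using (any?; all?)
open import Data.Bool using (Bool; true; false; _∧_; _∨_; not; if_then_else_)
import Data.Bool as Bool
open import Data.Bool.Properties using (∧-identityʳ; ¬-not; ∨-zeroʳ)
open import Data.Product using (_×_; _,_; proj₁; proj₂; ∃; ∃₂)
open import Data.Product.Properties using (,-injectiveˡ; ,-injectiveʳ)
open import Data.Sum using (_⊎_; inj₁; inj₂)
open import Data.Empty using (⊥; ⊥-elim)
open import Data.Unit using (⊤)
open import Function using (_∘_)
open import Relation.Nullary using (¬_; Dec; yes; no; ¬?)
open import Relation.Nullary.Decidable using (⌊_⌋; map′; _×-dec_; from-yes)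
open import Relation.Binary.PropositionalEquality

⌊⌋≡true : ∀ {A : Set} (a? : Dec A) → A → ⌊ a? ⌋ ≡ true
⌊⌋≡true (yes _) _ = refl
⌊⌋≡true (no ¬a) a = ⊥-elim (¬a a)

⌊⌋≡false : ∀ {A : Set} (a? : Dec A) → ¬ A → ⌊ a? ⌋ ≡ false
⌊⌋≡false (yes a) ¬a = ⊥-elim (¬a a)
⌊⌋≡false (no _)  _  = refl

⌊suc≟suc⌋ : ∀ {k} (i j : Fin k) → ⌊ suc j ≟ suc i ⌋ ≡ ⌊ j ≟ i ⌋
⌊suc≟suc⌋ i j with j ≟ i
... | yes _ = refl
... | no  _ = refl

count-cong : ∀ {k} {p q : Fin k → Bool} → (∀ i → p i ≡ q i) → count p ≡ count q
count-cong {zero}  p≗q = refl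
count-cong {suc k} p≗q rewrite p≗q zero = cong (_ +_) (count-cong (p≗q ∘ suc))

count≡0⇒false : ∀ {k} (p : Fin k → Bool) → count p ≡ 0 → ∀ i → p i ≡ false
count≡0⇒false {suc k} p eq i with p zero in p₀
count≡0⇒false {suc k} p eq zero    | false = p₀
count≡0⇒false {suc k} p eq (suc i) | false = count≡0⇒false (p ∘ suc) eq i

count≡suc⇒∃ : ∀ {k} (p : Fin k → Bool) {n} → count p ≡ suc n → ∃ λ i → p i ≡ true
count≡suc⇒∃ {suc k} p eq with p zero in p₀
... | true  = zero , p₀
... | false = let i , pi = count≡suc⇒∃ (p ∘ suc) eq in suc i , pi

_∖_ : ∀ {k} → (Fin k → Bool) → Fin k → Fin k → Bool
(p ∖ i) j = p j ∧ not ⌊ j ≟ i ⌋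

∖-intro : ∀ {k} (p : Fin k → Bool) {i j} → p j ≡ true → j ≢ i → (p ∖ i) j ≡ true
∖-intro p {i} {j} pj j≢i rewrite pj | ⌊⌋≡false (j ≟ i) j≢i = refl

∖-elim : ∀ {k} (p : Fin k → Bool) {i j} → (p ∖ i) j ≡ true → p j ≡ true × j ≢ i
∖-elim p {i} {j} h with p j | j ≟ i
∖-elim p ()   | false | _
∖-elim p ()   | true  | yes _
∖-elim p refl | true  | no j≢i = refl , j≢i

count-∖ : ∀ {k} (p : Fin k → Bool) {i} → p i ≡ true → count p ≡ suc (count (p ∖ i))
count-∖ {suc k} p {zero} p₀ rewrite p₀ =
  cong suc (count-cong (λ j → sym (∧-identityʳ (p (suc j)))))
count-∖ {suc k} p {suc i} pi =
  begin
    b₀ + count (p ∘ suc)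
  ≡⟨ cong (b₀ +_) (count-∖ (p ∘ suc) pi) ⟩
    b₀ + suc (count ((p ∘ suc) ∖ i))
  ≡⟨ +-suc b₀ _ ⟩
    suc (b₀ + count ((p ∘ suc) ∖ i))
  ≡⟨ cong₂ (λ b n → suc ((if b then 1 else 0) + n))
       (sym (∧-identityʳ (p zero)))
       (count-cong (λ j → cong (λ b → p (suc j) ∧ not b) (sym (⌊suc≟suc⌋ i j)))) ⟩
    suc (count (p ∖ suc i))
  ∎
  where
  open ≡-Reasoning
  b₀ : ℕ
  b₀ = if p zero then 1 else 0

count-∖≡ : ∀ {k} (p : Fin k → Bool) {i n} → p i ≡ true → count p ≡ suc n → count (p ∖ i) ≡ n
count-∖≡ p pi eq = cong ℕ.pred (trans (sym (count-∖ p pi)) eq)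

count≡1⇒unique : ∀ {k} (p : Fin k → Bool) → count p ≡ 1 →
  ∀ {i j} → p i ≡ true → p j ≡ true → j ≡ i
count≡1⇒unique p eq {i} {j} pi pj with j ≟ i
... | yes j≡i = j≡i
... | no  j≢i with trans (sym (∖-intro p pj j≢i)) (count≡0⇒false (p ∖ i) (count-∖≡ p pi eq) j)
... | ()

count≡2⇒two : ∀ {k} (p : Fin k → Bool) → count p ≡ 2 →
  ∃₂ λ i j → i ≢ j × p i ≡ true × p j ≡ true × (∀ l → p l ≡ true → l ≡ i ⊎ l ≡ j)
count≡2⇒two p eq with count≡suc⇒∃ p eq
... | i , pi with count≡suc⇒∃ (p ∖ i) (count-∖≡ p pi eq)
... | j , p∖i-j with ∖-elim p p∖i-j
... | pj , j≢i = i , j , (λ i≡j → j≢i (sym i≡j)) , pi , pj , only-i-j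
  where
  only-i-j : ∀ l → p l ≡ true → l ≡ i ⊎ l ≡ j
  only-i-j l pl with l ≟ i
  ... | yes l≡i = inj₁ l≡i
  ... | no  l≢i = inj₂ (count≡1⇒unique (p ∖ i) (count-∖≡ p pi eq) p∖i-j (∖-intro p pl l≢i))

≤count-∖⇒<count : ∀ {k} (p : Fin k → Bool) {i n} → p i ≡ true → n ≤ count (p ∖ i) → n < count p
≤count-∖⇒<count p pi n≤ rewrite count-∖ p pi = s≤s n≤

4≤count : ∀ {k} (p : Fin k → Bool) {a b c d} →
  p a ≡ true → p b ≡ true → p c ≡ true → p d ≡ true →
  a ≢ b → a ≢ c → a ≢ d → b ≢ c → b ≢ d → c ≢ d → 4 ≤ count p
4≤count p {a} {b} {c} {d} pa pb pc pd a≢b a≢c a≢d b≢c b≢d c≢d =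
  ≤count-∖⇒<count p pa
    (≤count-∖⇒<count (p ∖ a) (∖-intro p pb (≢-sym a≢b))
      (≤count-∖⇒<count ((p ∖ a) ∖ b) (∖-intro (p ∖ a) (∖-intro p pc (≢-sym a≢c)) (≢-sym b≢c))
        (≤count-∖⇒<count (((p ∖ a) ∖ b) ∖ c)
          (∖-intro ((p ∖ a) ∖ b) (∖-intro (p ∖ a) (∖-intro p pd (≢-sym a≢d)) (≢-sym b≢d)) (≢-sym c≢d))
          z≤n)))

enumerate : ∀ {k} (p : Fin k → Bool) →
  ∃ λ (f : Fin (count p) → Fin k) → ∀ i → p i ≡ true → ∃ λ j → f j ≡ i
enumerate {zero}  p = (λ ()) , λ ()
enumerate {suc k} p with enumerate (p ∘ suc)
... | f , onto with p zero in p₀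
... | true  = f′ , onto′
  where
  f′ : Fin (suc (count (p ∘ suc))) → Fin (suc k)
  f′ zero    = zero
  f′ (suc j) = suc (f j)
  onto′ : ∀ i → p i ≡ true → ∃ λ j → f′ j ≡ i
  onto′ zero    _  = zero , refl
  onto′ (suc i) pi = let j , fj≡i = onto i pi in suc j , cong suc fj≡i
... | false = suc ∘ f , onto′
  where
  onto′ : ∀ i → p i ≡ true → ∃ λ j → suc (f j) ≡ i
  onto′ zero pz with trans (sym pz) p₀
  ... | ()
  onto′ (suc i) pi = let j , fj≡i = onto i pi in j , cong suc fj≡i

-- Kept abstract: a with over an unfolding proof would normalise the whole decision procedure.
abstract
  three-colours-leave-two : ∀ (a b c : Fin 5) → ∃₂ λ c₁ c₂ → c₁ ≢ c₂ ×
    (c₁ ≢ a × c₁ ≢ b × c₁ ≢ c) × (c₂ ≢ a × c₂ ≢ b × c₂ ≢ c)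
  three-colours-leave-two = from-yes
    (all? λ a → all? λ b → all? λ c → any? λ c₁ → any? λ (c₂ : Fin 5) →
      ¬? (c₁ ≟ c₂) ×-dec avoids? a b c c₁ ×-dec avoids? a b c c₂)
    where
    avoids? : ∀ (a b c x : Fin 5) → Dec (x ≢ a × x ≢ b × x ≢ c)
    avoids? a b c x = ¬? (x ≟ a) ×-dec ¬? (x ≟ b) ×-dec ¬? (x ≟ c)

colours-among-three-leave-two : ∀ {m} (a : Fin m → Fin 5) x y z →
  (∀ j → a j ≡ x ⊎ a j ≡ y ⊎ a j ≡ z) →
  ∃₂ λ c₁ c₂ → c₁ ≢ c₂ × (∀ j → c₁ ≢ a j) × (∀ j → c₂ ≢ a j)
colours-among-three-leave-two a x y z among with three-colours-leave-two x y z
... | c₁ , c₂ , c₁≢c₂ , avoid₁ , avoid₂ = c₁ , c₂ , c₁≢c₂ , avoiding avoid₁ , avoiding avoid₂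
  where
  avoiding : ∀ {c} → c ≢ x × c ≢ y × c ≢ z → ∀ j → c ≢ a j
  avoiding (c≢x , c≢y , c≢z) j with among j
  ... | inj₁ refl        = c≢x
  ... | inj₂ (inj₁ refl) = c≢y
  ... | inj₂ (inj₂ refl) = c≢z

two-colours-avoiding : ∀ {m} → m ≤ 3 → (a : Fin m → Fin 5) →
  ∃₂ λ c₁ c₂ → c₁ ≢ c₂ × (∀ j → c₁ ≢ a j) × (∀ j → c₂ ≢ a j)
two-colours-avoiding {0} _ a = colours-among-three-leave-two a zero zero zero λ ()
two-colours-avoiding {1} _ a = colours-among-three-leave-two a (a zero) (a zero) (a zero)
  λ { zero → inj₁ refl }
two-colours-avoiding {2} _ a = colours-among-three-leave-two a (a zero) (a (suc zero)) (a zero)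
  λ { zero → inj₁ refl ; (suc zero) → inj₂ (inj₁ refl) }
two-colours-avoiding {3} _ a = colours-among-three-leave-two a (a zero) (a (suc zero)) (a (suc (suc zero)))
  λ { zero → inj₁ refl ; (suc zero) → inj₂ (inj₁ refl) ; (suc (suc zero)) → inj₂ (inj₂ refl) }
two-colours-avoiding {suc (suc (suc (suc _)))} (s≤s (s≤s (s≤s ())))

module _ (G : Multigraph) where

  -- A record rather than incident G v e ≡ true, so that v and e can be inferred from it.
  record Inc (v : Vertex G) (e : Edge G) : Set where
    constructor inc
    field incident≡true : incident G v e ≡ true

  open Inc public

  Inc? : ∀ v e → Dec (Inc v e)
  Inc? v e = map′ inc incident≡true (incident G v e Bool.≟ true)

  joins-sym : ∀ {e a b} → Joins G e a b → Joins G e b a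
  joins-sym (inj₁ eq) = inj₂ eq
  joins-sym (inj₂ eq) = inj₁ eq

  joins-ends : ∀ {e a b c d} → Joins G e a b → Joins G e c d → c ≡ a ⊎ c ≡ b
  joins-ends (inj₁ p) (inj₁ q) = inj₁ (,-injectiveˡ (trans (sym q) p))
  joins-ends (inj₁ p) (inj₂ q) = inj₂ (,-injectiveʳ (trans (sym q) p))
  joins-ends (inj₂ p) (inj₁ q) = inj₂ (,-injectiveˡ (trans (sym q) p))
  joins-ends (inj₂ p) (inj₂ q) = inj₁ (,-injectiveʳ (trans (sym q) p))

  joins-functional : ∀ {e a b b′} → Joins G e a b → Joins G e a b′ → b ≡ b′
  joins-functional (inj₁ p) (inj₁ q) = ,-injectiveʳ (trans (sym p) q)
  joins-functional (inj₁ p) (inj₂ q) =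
    trans (,-injectiveʳ (trans (sym p) q)) (,-injectiveˡ (trans (sym p) q))
  joins-functional (inj₂ p) (inj₁ q) =
    trans (,-injectiveˡ (trans (sym p) q)) (,-injectiveʳ (trans (sym p) q))
  joins-functional (inj₂ p) (inj₂ q) = ,-injectiveˡ (trans (sym p) q)

  joins⇒inc : ∀ {e a b} → Joins G e a b → Inc a e
  joins⇒inc {e} {a} J = inc (joins⇒incident J)
    where
    joins⇒incident : ∀ {b} → Joins G e a b → incident G a e ≡ true
    joins⇒incident (inj₁ eq) rewrite eq | ⌊⌋≡true (a ≟ a) refl = refl
    joins⇒incident (inj₂ eq) rewrite eq | ⌊⌋≡true (a ≟ a) refl = ∨-zeroʳ _

  inc⇒joins : ∀ {e a} → Inc a e → ∃ λ b → Joins G e a b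
  inc⇒joins {e} {a} (inc h) with proj₁ (ends G e) ≟ a | proj₂ (ends G e) ≟ a
  ... | yes p | _     = proj₂ (ends G e) , inj₁ (cong (_, proj₂ (ends G e)) p)
  ... | no _  | yes q = proj₁ (ends G e) , inj₂ (cong (proj₁ (ends G e) ,_) q)
  inc⇒joins (inc ()) | no _ | no _

  ≢ends⇒¬inc : ∀ {e a b v} → Joins G e a b → a ≢ v → b ≢ v → ¬ Inc v e
  ≢ends⇒¬inc J a≢v b≢v ve with joins-ends J (proj₂ (inc⇒joins ve))
  ... | inj₁ v≡a = a≢v (sym v≡a)
  ... | inj₂ v≡b = b≢v (sym v≡b)

  ¬inc⇒≢ : ∀ {e a b v} → Joins G e a b → ¬ Inc v e → a ≢ v
  ¬inc⇒≢ J ¬ve refl = ¬ve (joins⇒inc J)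

  at-most-three-edges : Subcubic G → ∀ {v e₁ e₂ e₃ f} →
    Inc v e₁ → Inc v e₂ → Inc v e₃ → e₁ ≢ e₂ → e₁ ≢ e₃ → e₂ ≢ e₃ →
    Inc v f → f ≡ e₁ ⊎ f ≡ e₂ ⊎ f ≡ e₃
  at-most-three-edges sub {v} {e₁} {e₂} {e₃} {f} ve₁ ve₂ ve₃ e₁≢e₂ e₁≢e₃ e₂≢e₃ vf
    with f ≟ e₁ | f ≟ e₂ | f ≟ e₃
  ... | yes f≡e₁ | _        | _        = inj₁ f≡e₁
  ... | no _     | yes f≡e₂ | _        = inj₂ (inj₁ f≡e₂)
  ... | no _     | no _     | yes f≡e₃ = inj₂ (inj₂ f≡e₃)
  ... | no f≢e₁  | no f≢e₂  | no f≢e₃  = ⊥-elim (<⇒≱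
    (4≤count (incident G v) (incident≡true ve₁) (incident≡true ve₂) (incident≡true ve₃) (incident≡true vf)
      e₁≢e₂ e₁≢e₃ (≢-sym f≢e₁) e₂≢e₃ (≢-sym f≢e₂) (≢-sym f≢e₃))
    (sub v))

  record MissingColours (colour : Edge G → Fin 5) (z : Vertex G) : Set where
    field
      c₁ c₂      : Fin 5
      c₁≢c₂      : c₁ ≢ c₂
      c₁-missing : ∀ g → Inc z g → c₁ ≢ colour g
      c₂-missing : ∀ g → Inc z g → c₂ ≢ colour g

  missing-colours : Subcubic G → ∀ colour z → MissingColours colour z
  missing-colours sub colour z with enumerate (incident G z)
  ... | f , onto with two-colours-avoiding (sub z) (colour ∘ f)
  ... | c₁ , c₂ , c₁≢c₂ , avoid₁ , avoid₂ = record
    { c₁ = c₁ ; c₂ = c₂ ; c₁≢c₂ = c₁≢c₂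
    ; c₁-missing = λ g zg → let j , fj≡g = onto g (incident≡true zg) in
        subst (λ h → c₁ ≢ colour h) fj≡g (avoid₁ j)
    ; c₂-missing = λ g zg → let j , fj≡g = onto g (incident≡true zg) in
        subst (λ h → c₂ ≢ colour h) fj≡g (avoid₂ j)
    }

  -- As v has the single neighbour t, a path or cycle of length four can contain an edge at v
  -- only as its first or last edge, and then its third edge meets a neighbour of t.
  module _ {k : ℕ} (v t : Vertex G)
           (towards-t : ∀ e → Inc v e → Joins G e v t)
           (c : StarColoringOn G (λ u → u ≢ v) k)
           (new : Edge G → Fin k)
           (new-proper : ∀ e e′ → Inc v e → Inc v e′ → e ≢ e′ → new e ≢ new e′)
           (new-fresh : ∀ e f g s s′ → Inc v e → ¬ Inc v f → ¬ Inc v g →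
                        Joins G f t s → Joins G g s s′ → new e ≢ StarColoringOn.col c g)
    where

    open StarColoringOn c renaming (col to old; proper to old-proper; noBicolored4 to old-star)

    private
      col′ : Edge G → Fin k
      col′ e = if incident G v e then new e else old e

      col′-new : ∀ {e} → Inc v e → col′ e ≡ new e
      col′-new {e} ve = cong (λ b → if b then new e else old e) (incident≡true ve)

      col′-old : ∀ {e} → ¬ Inc v e → col′ e ≡ old e
      col′-old {e} ¬ve = cong (λ b → if b then new e else old e) (¬-not (¬ve ∘ inc))

      only-t : ∀ {e b} → Joins G e v b → b ≡ t
      only-t {e} J = joins-functional J (towards-t e (joins⇒inc J))

      through-v : ∀ {e e′ a b} → Joins G e a v → Joins G e′ v b → a ≡ b
      through-v J J′ = trans (only-t (joins-sym J)) (sym (only-t J′))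

      new≢old-at : ∀ {e f a w w′} → Inc v e → ¬ Inc v f → Joins G e a w → Joins G f a w′ → new e ≢ old f
      new≢old-at {e} {f} {w′ = w′} ve ¬vf Je Jf with joins-ends (towards-t e ve) Je
      ... | inj₁ a≡v = ⊥-elim (¬inc⇒≢ Jf ¬vf a≡v)
      ... | inj₂ refl = new-fresh e f f w′ t ve ¬vf ¬vf Jf (joins-sym Jf)

      proper′ : ∀ (e f : Edge G) (a w w′ : Vertex G) → e ≢ f → ⊤ → ⊤ → ⊤ →
                Joins G e a w → Joins G f a w′ → col′ e ≢ col′ f
      proper′ e f a w w′ e≢f _ _ _ Je Jf with Inc? v e | Inc? v f
      ... | yes ve | yes vf = subst₂ _≢_ (sym (col′-new ve)) (sym (col′-new vf)) (new-proper e f ve vf e≢f)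
      ... | yes ve | no ¬vf = subst₂ _≢_ (sym (col′-new ve)) (sym (col′-old ¬vf)) (new≢old-at ve ¬vf Je Jf)
      ... | no ¬ve | yes vf = subst₂ _≢_ (sym (col′-old ¬ve)) (sym (col′-new vf))
        (≢-sym (new≢old-at vf ¬ve Jf Je))
      ... | no ¬ve | no ¬vf = subst₂ _≢_ (sym (col′-old ¬ve)) (sym (col′-old ¬vf))
        (old-proper e f a w w′ e≢f (¬inc⇒≢ Je ¬ve) (¬inc⇒≢ (joins-sym Je) ¬ve)
          (¬inc⇒≢ (joins-sym Jf) ¬vf) Je Jf)

      new-colour-not-repeated : ∀ {v₁ v₂ v₃ e₁ e₂ e₃} →
        Joins G e₁ v v₁ → Joins G e₂ v₁ v₂ → Joins G e₃ v₂ v₃ → v₁ ≢ v → v₂ ≢ v → v₃ ≢ v →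
        col′ e₁ ≢ col′ e₃
      new-colour-not-repeated {v₂ = v₂} {v₃} {e₁} {e₂} {e₃} J₁ J₂ J₃ v₁≢v v₂≢v v₃≢v same with only-t J₁
      ... | refl = new-fresh e₁ e₂ e₃ v₂ v₃ ve₁ ¬ve₂ ¬ve₃ J₂ J₃
                     (trans (sym (col′-new ve₁)) (trans same (col′-old ¬ve₃)))
        where
        ve₁ : Inc v e₁
        ve₁ = joins⇒inc J₁
        ¬ve₂ : ¬ Inc v e₂
        ¬ve₂ = ≢ends⇒¬inc J₂ v₁≢v v₂≢v
        ¬ve₃ : ¬ Inc v e₃
        ¬ve₃ = ≢ends⇒¬inc J₃ v₂≢v v₃≢v

      star′ : ∀ (v₀ v₁ v₂ v₃ v₄ : Vertex G) (e₁ e₂ e₃ e₄ : Edge G) → ⊤ → ⊤ → ⊤ → ⊤ → ⊤ →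
              Joins G e₁ v₀ v₁ → Joins G e₂ v₁ v₂ → Joins G e₃ v₂ v₃ → Joins G e₄ v₃ v₄ →
              v₀ ≢ v₁ → v₀ ≢ v₂ → v₀ ≢ v₃ → v₁ ≢ v₂ → v₁ ≢ v₃ → v₂ ≢ v₃ →
              ((v₄ ≢ v₀ × v₄ ≢ v₁ × v₄ ≢ v₂ × v₄ ≢ v₃) ⊎ v₄ ≡ v₀) →
              col′ e₁ ≡ col′ e₃ → col′ e₂ ≡ col′ e₄ → ⊥
      star′ v₀ v₁ v₂ v₃ v₄ e₁ e₂ e₃ e₄ _ _ _ _ _ J₁ J₂ J₃ J₄ d01 d02 d03 d12 d13 d23 end same₁₃ same₂₄
        with v₀ ≟ v | v₁ ≟ v | v₂ ≟ v | v₃ ≟ v | v₄ ≟ v | end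
      ... | _ | yes refl | _ | _ | _ | _ = d02 (through-v J₁ J₂)
      ... | _ | _ | yes refl | _ | _ | _ = d13 (through-v J₂ J₃)
      ... | _ | _ | _ | yes refl | _ | inj₁ (_ , _ , v₄≢v₂ , _) = v₄≢v₂ (sym (through-v J₃ J₄))
      ... | _ | _ | _ | yes refl | _ | inj₂ refl = d02 (sym (through-v J₃ J₄))
      ... | yes refl | _ | _ | _ | _ | inj₂ refl = d13 (sym (through-v J₄ J₁))
      ... | yes refl | no v₁≢v | no v₂≢v | no v₃≢v | _ | inj₁ _ =
        new-colour-not-repeated J₁ J₂ J₃ v₁≢v v₂≢v v₃≢v same₁₃
      ... | no v₀≢v | _ | _ | _ | yes refl | inj₂ v≡v₀ = v₀≢v (sym v≡v₀)
      ... | no _ | no v₁≢v | no v₂≢v | no v₃≢v | yes refl | inj₁ _ =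
        new-colour-not-repeated (joins-sym J₄) (joins-sym J₃) (joins-sym J₂) v₃≢v v₂≢v v₁≢v (sym same₂₄)
      ... | no v₀≢v | no v₁≢v | no v₂≢v | no v₃≢v | no v₄≢v | _ =
        old-star v₀ v₁ v₂ v₃ v₄ e₁ e₂ e₃ e₄ v₀≢v v₁≢v v₂≢v v₃≢v v₄≢v J₁ J₂ J₃ J₄ d01 d02 d03 d12 d13 d23 end
          (trans (sym (col′-old (≢ends⇒¬inc J₁ v₀≢v v₁≢v)))
                 (trans same₁₃ (col′-old (≢ends⇒¬inc J₃ v₂≢v v₃≢v))))
          (trans (sym (col′-old (≢ends⇒¬inc J₂ v₁≢v v₂≢v)))
                 (trans same₂₄ (col′-old (≢ends⇒¬inc J₄ v₃≢v v₄≢v))))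

    extend-star-colouring : StarColorable G k
    extend-star-colouring = record { col = col′ ; proper = proper′ ; noBicolored4 = star′ }

  EndH : Vertex G → Vertex G → Vertex G → Bool
  EndH x a b = ⌊ a ≟ x ⌋ ∧ keptH G b

  EndsH : Vertex G → Vertex G × Vertex G → Bool
  EndsH x (a , b) = EndH x a b ∨ EndH x b a

  -- degH G x is definitionally count (EdgeH x).
  EdgeH : Vertex G → Edge G → Bool
  EdgeH x e = EndsH x (ends G e)

  EndH-intro : ∀ {x b} → keptH G b ≡ true → EndH x x b ≡ true
  EndH-intro {x} kb rewrite ⌊⌋≡true (x ≟ x) refl = kb

  EndH-elim : ∀ {x a b} → EndH x a b ≡ true → a ≡ x × keptH G b ≡ true
  EndH-elim {x} {a} {b} h with a ≟ x
  ... | yes a≡x = a≡x , h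

  EdgeH-intro : ∀ {x e w} → Joins G e x w → keptH G w ≡ true → EdgeH x e ≡ true
  EdgeH-intro {x} {w = w} (inj₁ eq) kw =
    trans (cong (EndsH x) eq) (cong (_∨ EndH x w x) (EndH-intro kw))
  EdgeH-intro {x} {w = w} (inj₂ eq) kw =
    trans (cong (EndsH x) eq) (trans (cong (EndH x w x ∨_) (EndH-intro kw)) (∨-zeroʳ _))

  EdgeH-elim : ∀ {x e} → EdgeH x e ≡ true → ∃ λ w → Joins G e x w × keptH G w ≡ true
  EdgeH-elim {x} {e} h with EndH x (proj₁ (ends G e)) (proj₂ (ends G e)) in end₁
  ... | true  = let a≡x , kb = EndH-elim end₁ in _ , inj₁ (cong (_, _) a≡x) , kb
  ... | false = let b≡x , ka = EndH-elim h in _ , inj₂ (cong (_ ,_) b≡x) , ka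

  ¬kept⇒deg≡1 : ∀ {w} → keptH G w ≢ true → deg G w ≡ 1
  ¬kept⇒deg≡1 {w} ¬kw with deg G w ℕ.≟ 1
  ... | yes d≡1 = d≡1
  ... | no  _   = ⊥-elim (¬kw refl)

  ¬digon-with-pendant : Subcubic G → Star5Critical G → ∀ {x y u e₁ e₂ p} →
    e₁ ≢ e₂ → Joins G e₁ x y → Joins G e₂ x y →
    Joins G p x u → p ≢ e₁ → p ≢ e₂ → deg G u ≡ 1 → ⊥
  ¬digon-with-pendant sub (¬col , col-minus) {x} {y} {u} {p = p} e₁≢e₂ J₁ J₂ Jp p≢e₁ p≢e₂ deg-u≡1 =
    ¬col (extend-star-colouring u x only-to-x (col-minus u) (λ _ → c₁) one-edge fresh)
    where
    open StarColoringOn (col-minus u) using (col)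
    open MissingColours (missing-colours sub col y)
    up : Inc u p
    up = joins⇒inc (joins-sym Jp)
    only-p : ∀ {e} → Inc u e → e ≡ p
    only-p ue = count≡1⇒unique (incident G u) deg-u≡1 (incident≡true up) (incident≡true ue)
    only-to-x : ∀ e → Inc u e → Joins G e u x
    only-to-x e ue = subst (λ h → Joins G h u x) (sym (only-p ue)) (joins-sym Jp)
    one-edge : ∀ e e′ → Inc u e → Inc u e′ → e ≢ e′ → c₁ ≢ c₁
    one-edge e e′ ue ue′ e≢e′ _ = e≢e′ (trans (only-p ue) (sym (only-p ue′)))
    fresh : ∀ e f g s s′ → Inc u e → ¬ Inc u f → ¬ Inc u g → Joins G f x s → Joins G g s s′ → c₁ ≢ col g
    fresh _ f g s _ _ ¬uf _ Jf Jg = c₁-missing g (subst (λ w → Inc w g) s≡y (joins⇒inc Jg))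
      where
      s≡y : s ≡ y
      s≡y with at-most-three-edges sub (joins⇒inc J₁) (joins⇒inc J₂) (joins⇒inc Jp)
                 e₁≢e₂ (≢-sym p≢e₁) (≢-sym p≢e₂) (joins⇒inc Jf)
      ... | inj₁ refl        = joins-functional Jf J₁
      ... | inj₂ (inj₁ refl) = joins-functional Jf J₂
      ... | inj₂ (inj₂ refl) = ⊥-elim (¬uf up)

  one-neighbour-beyond-digon : Subcubic G → ∀ {x y e₁ e₂} →
    e₁ ≢ e₂ → Joins G e₁ x y → Joins G e₂ x y →
    ∃ λ z → ∀ {f s} → ¬ Inc x f → Joins G f y s → s ≡ z
  one-neighbour-beyond-digon sub {x} {y} e₁≢e₂ J₁ J₂
    with any? (λ f → Inc? y f ×-dec ¬? (Inc? x f))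
  ... | no none = y , λ ¬xf Jf → ⊥-elim (none (_ , joins⇒inc Jf , ¬xf))
  ... | yes (f₀ , yf₀ , ¬xf₀) with inc⇒joins yf₀
  ... | z , J₀ = z , beyond
    where
    ≢-off-x : ∀ {e f} → Inc x e → ¬ Inc x f → e ≢ f
    ≢-off-x xe ¬xf refl = ¬xf xe
    beyond : ∀ {f s} → ¬ Inc x f → Joins G f y s → s ≡ z
    beyond ¬xf Jf
      with at-most-three-edges sub (joins⇒inc (joins-sym J₁)) (joins⇒inc (joins-sym J₂)) yf₀
             e₁≢e₂ (≢-off-x (joins⇒inc J₁) ¬xf₀) (≢-off-x (joins⇒inc J₂) ¬xf₀) (joins⇒inc Jf)
    ... | inj₁ refl        = ⊥-elim (¬xf (joins⇒inc J₁))
    ... | inj₂ (inj₁ refl) = ⊥-elim (¬xf (joins⇒inc J₂))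
    ... | inj₂ (inj₂ refl) = joins-functional Jf J₀

  ¬isolated-digon : Subcubic G → Star5Critical G → ∀ {x y e₁ e₂} →
    e₁ ≢ e₂ → Joins G e₁ x y → Joins G e₂ x y → (∀ {e} → Inc x e → e ≡ e₁ ⊎ e ≡ e₂) → ⊥
  ¬isolated-digon sub (¬col , col-minus) {x} {y} {e₁} {e₂} e₁≢e₂ J₁ J₂ only =
    ¬col (extend-star-colouring x y to-y (col-minus x) new distinct fresh)
    where
    open StarColoringOn (col-minus x) using (col)
    beyond : ∃ λ z → ∀ {f s} → ¬ Inc x f → Joins G f y s → s ≡ z
    beyond = one-neighbour-beyond-digon sub e₁≢e₂ J₁ J₂
    z : Vertex G
    z = proj₁ beyond
    z-inc : ∀ {f g s s′} → ¬ Inc x f → Joins G f y s → Joins G g s s′ → Inc z g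
    z-inc {g = g} ¬xf Jf Jg = subst (λ w → Inc w g) (proj₂ beyond ¬xf Jf) (joins⇒inc Jg)
    open MissingColours (missing-colours sub col z)
    new : Edge G → Fin 5
    new e = if ⌊ e ≟ e₁ ⌋ then c₁ else c₂
    new-e₁ : new e₁ ≡ c₁
    new-e₁ rewrite ⌊⌋≡true (e₁ ≟ e₁) refl = refl
    new-e₂ : new e₂ ≡ c₂
    new-e₂ rewrite ⌊⌋≡false (e₂ ≟ e₁) (≢-sym e₁≢e₂) = refl
    to-y : ∀ e → Inc x e → Joins G e x y
    to-y e xe with only xe
    ... | inj₁ refl = J₁
    ... | inj₂ refl = J₂
    distinct : ∀ e e′ → Inc x e → Inc x e′ → e ≢ e′ → new e ≢ new e′
    distinct e e′ xe xe′ e≢e′ with only xe | only xe′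
    ... | inj₁ refl | inj₁ refl = ⊥-elim (e≢e′ refl)
    ... | inj₁ refl | inj₂ refl = subst₂ _≢_ (sym new-e₁) (sym new-e₂) c₁≢c₂
    ... | inj₂ refl | inj₁ refl = subst₂ _≢_ (sym new-e₂) (sym new-e₁) (≢-sym c₁≢c₂)
    ... | inj₂ refl | inj₂ refl = ⊥-elim (e≢e′ refl)
    fresh : ∀ e f g s s′ → Inc x e → ¬ Inc x f → ¬ Inc x g → Joins G f y s → Joins G g s s′ → new e ≢ col g
    fresh e f g _ _ xe ¬xf _ Jf Jg with only xe
    ... | inj₁ refl = subst (_≢ col g) (sym new-e₁) (c₁-missing g (z-inc ¬xf Jf Jg))
    ... | inj₂ refl = subst (_≢ col g) (sym new-e₂) (c₂-missing g (z-inc ¬xf Jf Jg))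

  ¬digon-in-H : Subcubic G → Star5Critical G → ∀ {x y e₁ e₂} →
    e₁ ≢ e₂ → Joins G e₁ x y → Joins G e₂ x y →
    (∀ e → EdgeH x e ≡ true → e ≡ e₁ ⊎ e ≡ e₂) → ⊥
  ¬digon-in-H sub crit {x} {e₁ = e₁} {e₂} e₁≢e₂ J₁ J₂ only-H
    with any? (λ p → Inc? x p ×-dec ¬? (p ≟ e₁) ×-dec ¬? (p ≟ e₂))
  ... | yes (p , xp , p≢e₁ , p≢e₂) =
    let _ , Jp = inc⇒joins xp in
    ¬digon-with-pendant sub crit e₁≢e₂ J₁ J₂ Jp p≢e₁ p≢e₂ (¬kept⇒deg≡1 (far-end-not-kept Jp))
    where
    far-end-not-kept : ∀ {u} → Joins G p x u → keptH G u ≢ true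
    far-end-not-kept Jp ku with only-H p (EdgeH-intro Jp ku)
    ... | inj₁ p≡e₁ = p≢e₁ p≡e₁
    ... | inj₂ p≡e₂ = p≢e₂ p≡e₂
  ... | no no-third = ¬isolated-digon sub crit e₁≢e₂ J₁ J₂ only
    where
    only : ∀ {e} → Inc x e → e ≡ e₁ ⊎ e ≡ e₂
    only {e} xe with e ≟ e₁ | e ≟ e₂
    ... | yes e≡e₁ | _        = inj₁ e≡e₁
    ... | no _     | yes e≡e₂ = inj₂ e≡e₂
    ... | no e≢e₁  | no e≢e₂  = ⊥-elim (no-third (e , xe , e≢e₁ , e≢e₂))

lemma2p3 : (G : Multigraph) → Subcubic G → Star5Critical G →
    (x : Vertex G) → keptH G x ≡ true → degH G x ≡ 2 →
    ∃ λ y → ∃ λ z → y ≢ z × NeighborH G x y × NeighborH G x z ×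
      (∀ w → NeighborH G x w → w ≡ y ⊎ w ≡ z)
lemma2p3 G sub crit x _ degH≡2 with count≡2⇒two (EdgeH G x) degH≡2
... | e₁ , e₂ , e₁≢e₂ , h₁ , h₂ , only-H with EdgeH-elim G h₁ | EdgeH-elim G h₂
... | y , J₁ , ky | z , J₂ , kz with y ≟ z
... | yes refl = ⊥-elim (¬digon-in-H G sub crit e₁≢e₂ J₁ J₂ only-H)
... | no y≢z = y , z , y≢z , (ky , e₁ , J₁) , (kz , e₂ , J₂) , neighbour-is-y-or-z
  where
  neighbour-is-y-or-z : ∀ w → NeighborH G x w → w ≡ y ⊎ w ≡ z
  neighbour-is-y-or-z w (kw , e , J) with only-H e (EdgeH-intro G J kw)
  ... | inj₁ refl = inj₁ (joins-functional G J J₁)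
  ... | inj₂ refl = inj₂ (joins-functional G J J₂)
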